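{- Over Bishop-style constructive mathematics, UCT$_c'$ implies DFT. Here: - UCT$_c'$: every function $f\colon[0,1]\to\mathbb{R}$ with a continuous ternary modulus is uniformly continuous. - DFT: every decidable bar $B\subseteq\{0,1\}^*$ is uniform.
   Context: The setting is constructive. A set $B\subseteq\{0,1\}^*$ is a bar if $\forall\alpha\in\{0,1\}^{\mathbb{N}}\,\exists n\,B(\overline{\alpha}n)$. It is uniform if $\exists N\,\forall\alpha\,\exists n\le N\,B(\overline{\alpha}n)$. It is decidable if membership is decidable. Real numbers are regular sequences of rationals $\langle r_n\rangle$ with $|r_n-r_{n+1}|\le2^{ -(n+1)}$. Equality is $\langle r_n\rangle\simeq\langle q_n\rangle$ iff $\forall n\,|r_{n+1}-q_{n+1}|\le2^{ -n}$. Functions $[0,1]\to\mathbb{R}$ respect $\simeq$. For $s\in\{0,1,2\}^*$, define $N(\langle\rangle)=1$ and $N(s*\langle i\rangle)=2N(s)+(i-1)$. For $\alpha\in\{0,1,2\}^{\mathbb{N}}$, $\Phi(\alpha)=\langle2^{ -(n+1)}N(\overline{\alpha}n)\rangle_n$. A ternary modulus of $f$ is $g\colon\mathbb{N}\to\{0,1,2\}^{\mathbb{N}}\to\mathbb{N}$ with $\forall k\,\forall\alpha\,\forall x\in[0,1]\,(|\Phi(\alpha)-x|\le2^{ -g_k(\alpha)}\to|f(\Phi(\alpha))-f(x)|\le2^{ -k})$. It is continuous if each $g_k$ is pointwise continuous: $\forall\alpha\,\exists n\,\forall\beta\,(\overline{\alpha}n=\overline{\beta}n\to g_k(\alpha)=g_k(\beta))$.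 $f$ is uniformly continuous if there is $\omega$ with $\forall k\,\forall x,y\in[0,1]\,(|x-y|\le2^{ -\omega(k)}\to|f(x)-f(y)|\le2^{ -k})$. -}

module Defs where

open import Data.Nat as ℕ using (ℕ; zero; suc; _<_)
open import Data.Fin using (Fin; zero; suc)
open import Data.Bool using (Bool)
open import Data.List using (List; []; _∷ʳ_)
open import Data.Product using (Σ; ∃; ∃-syntax; _×_; _,_; proj₁; proj₂)
open import Data.Rational using (ℚ; _+_; _*_; _-_; -_; ∣_∣; _≤_; 0ℚ; 1ℚ; ½)
open import Data.Rational.Properties
open import Relation.Binary.PropositionalEquality
open import Relation.Nullary using (Dec)
open import Data.Rational.Solver using (module +-*-Solver)
open +-*-Solver

initSeg : {A : Set} → (ℕ → A) → ℕ → List A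
initSeg α zero    = []
initSeg α (suc n) = initSeg α n ∷ʳ α n

IsBar : (List Bool → Set) → Set
IsBar B = (α : ℕ → Bool) → ∃[ n ] B (initSeg α n)

IsUniform : (List Bool → Set) → Set
IsUniform B = ∃[ N ] ((α : ℕ → Bool) → ∃[ n ] (n ℕ.≤ N × B (initSeg α n)))

IsDecidable : (List Bool → Set) → Set
IsDecidable B = (s : List Bool) → Dec (B s)

DFT : Set₁
DFT = (B : List Bool → Set) → IsDecidable B → IsBar B → IsUniform B

two : ℚ
two = 1ℚ + 1ℚ

half^ : ℕ → ℚ
half^ zero    = 1ℚ
half^ (suc k) = ½ * half^ k

record ℝ : Set where
  constructor mkℝ
  field
    seq : ℕ → ℚ
    reg : (n : ℕ) → ∣ seq n - seq (suc n) ∣ ≤ half^ (suc n)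
open ℝ public

_≃_ : ℝ → ℝ → Set
x ≃ y = (n : ℕ) → ∣ seq x (suc n) - seq y (suc n) ∣ ≤ half^ n

-- The usual operations on (representing) sequences, used to unfold
-- the real-number relations 0 ≤ x, x ≤ 1 and |x - y| ≤ 2^{-k}.
-- (x - y)_n = x_{n+1} - y_{n+1};  |x|_n = |x_n|;  constants q_n = q;
-- x ≤ y  iff  ∀ n, x_n - y_n ≤ 2·2^{-n}.
subˢ : (ℕ → ℚ) → (ℕ → ℚ) → ℕ → ℚ
subˢ x y n = x (suc n) - y (suc n)

absˢ : (ℕ → ℚ) → ℕ → ℚ
absˢ x n = ∣ x n ∣

constˢ : ℚ → ℕ → ℚ
constˢ q n = q

_≤ˢ_ : (ℕ → ℚ) → (ℕ → ℚ) → Set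
x ≤ˢ y = (n : ℕ) → x n - y n ≤ two * half^ n

DistLe : ℝ → ℝ → ℕ → Set
DistLe x y k = absˢ (subˢ (seq x) (seq y)) ≤ˢ constˢ (half^ k)

I : Set
I = Σ ℝ (λ x → (constˢ 0ℚ ≤ˢ seq x) × (seq x ≤ˢ constˢ 1ℚ))

val : I → ℝ
val = proj₁

Respects≃ : (I → ℝ) → Set
Respects≃ f = (x y : I) → val x ≃ val y → f x ≃ f y

digit : Fin 3 → ℚ
digit zero             = - 1ℚ
digit (suc zero)       = 0ℚ
digit (suc (suc zero)) = 1ℚ

-- Nᾱ α n = N(ᾱn), where N(⟨⟩) = 1 and N(s * ⟨i⟩) = 2 N(s) + (i - 1)
Nᾱ : (ℕ → Fin 3) → ℕ → ℚ
Nᾱ α zero    = 1ℚ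
Nᾱ α (suc n) = two * Nᾱ α n + digit (α n)

Φseq : (ℕ → Fin 3) → ℕ → ℚ
Φseq α n = half^ (suc n) * Nᾱ α n

private
  stepEq : ∀ h N e → (½ * h) * (two * N + e) ≡ h * N + ½ * h * e
  stepEq = solve 3 (λ h N e → (con ½ :* h) :* (con two :* N :+ e) := h :* N :+ con ½ :* h :* e) refl

  halve : ∀ h → h ≡ ½ * h + ½ * h
  halve = solve 1 (λ h → h := con ½ :* h :+ con ½ :* h) refl

  half^-nonneg : ∀ k → 0ℚ ≤ half^ k
  half^-nonneg zero = nonNegative⁻¹ 1ℚ
  half^-nonneg (suc k) = ≤-trans (≤-reflexive (sym (*-zeroʳ ½))) (*-monoˡ-≤-nonNeg ½ (half^-nonneg k))

  ½h-nonneg : ∀ h → 0ℚ ≤ h → 0ℚ ≤ ½ * h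
  ½h-nonneg h p = ≤-trans (≤-reflexive (sym (*-zeroʳ ½))) (*-monoˡ-≤-nonNeg ½ p)

  ≤+nonneg : ∀ x r → 0ℚ ≤ r → x ≤ x + r
  ≤+nonneg x r p = ≤-trans (≤-reflexive (sym (+-identityʳ x))) (+-monoʳ-≤ x p)

  -nonneg≤ : ∀ x r → 0ℚ ≤ r → x - r ≤ x
  -nonneg≤ x r p = ≤-trans (+-monoʳ-≤ x (neg-antimono-≤ p)) (≤-reflexive (+-identityʳ x))

  ½h≤h : ∀ h → 0ℚ ≤ h → ½ * h ≤ h
  ½h≤h h p = ≤-trans (≤+nonneg (½ * h) (½ * h) (½h-nonneg h p)) (≤-reflexive (sym (halve h)))

  lo-eq₀ : ∀ h → h + ½ * h * - 1ℚ ≡ ½ * h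
  lo-eq₀ = solve 1 (λ h → h :+ con ½ :* h :* con (- 1ℚ) := con ½ :* h) refl
  lo-eq₁ : ∀ h → h + ½ * h * 0ℚ ≡ h
  lo-eq₁ = solve 1 (λ h → h :+ con ½ :* h :* con 0ℚ := h) refl
  lo-eq₂ : ∀ h → h + ½ * h * 1ℚ ≡ h + ½ * h
  lo-eq₂ = solve 1 (λ h → h :+ con ½ :* h :* con 1ℚ := h :+ con ½ :* h) refl

  stepLo : ∀ {P h} (d : Fin 3) → 0ℚ ≤ h → h ≤ P → ½ * h ≤ P + ½ * h * digit d
  stepLo {P} {h} d h≥0 h≤P = ≤-trans (aux d) (+-monoˡ-≤ (½ * h * digit d) h≤P)
    where
    aux : ∀ d → ½ * h ≤ h + ½ * h * digit d
    aux zero = ≤-reflexive (sym (lo-eq₀ h))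
    aux (suc zero) = ≤-trans (½h≤h h h≥0) (≤-reflexive (sym (lo-eq₁ h)))
    aux (suc (suc zero)) = ≤-trans (≤-trans (½h≤h h h≥0) (≤+nonneg h (½ * h) (½h-nonneg h h≥0))) (≤-reflexive (sym (lo-eq₂ h)))

  hi-eq₀ : ∀ h → 1ℚ - h + ½ * h * - 1ℚ ≡ (1ℚ - ½ * h) - (½ * h + ½ * h)
  hi-eq₀ = solve 1 (λ h → con 1ℚ :- h :+ con ½ :* h :* con (- 1ℚ) := (con 1ℚ :- con ½ :* h) :- (con ½ :* h :+ con ½ :* h)) refl
  hi-eq₁ : ∀ h → 1ℚ - h + ½ * h * 0ℚ ≡ (1ℚ - ½ * h) - ½ * h
  hi-eq₁ = solve 1 (λ h → con 1ℚ :- h :+ con ½ :* h :* con 0ℚ := (con 1ℚ :- con ½ :* h) :- con ½ :* h) refl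
  hi-eq₂ : ∀ h → 1ℚ - h + ½ * h * 1ℚ ≡ 1ℚ - ½ * h
  hi-eq₂ = solve 1 (λ h → con 1ℚ :- h :+ con ½ :* h :* con 1ℚ := con 1ℚ :- con ½ :* h) refl

  stepHi : ∀ {P h} (d : Fin 3) → 0ℚ ≤ h → P ≤ 1ℚ - h → P + ½ * h * digit d ≤ 1ℚ - ½ * h
  stepHi {P} {h} d h≥0 P≤ = ≤-trans (+-monoˡ-≤ (½ * h * digit d) P≤) (aux d)
    where
    q≥0 = ½h-nonneg h h≥0
    aux : ∀ d → 1ℚ - h + ½ * h * digit d ≤ 1ℚ - ½ * h
    aux zero = ≤-trans (≤-reflexive (hi-eq₀ h)) (-nonneg≤ _ _ (≤-trans q≥0 (≤+nonneg _ _ q≥0)))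
    aux (suc zero) = ≤-trans (≤-reflexive (hi-eq₁ h)) (-nonneg≤ _ _ q≥0)
    aux (suc (suc zero)) = ≤-reflexive (hi-eq₂ h)

  Φ-step : ∀ α n → Φseq α (suc n) ≡ Φseq α n + ½ * half^ (suc n) * digit (α n)
  Φ-step α n = stepEq (half^ (suc n)) (Nᾱ α n) (digit (α n))

  Φ-inv : ∀ α n → (half^ (suc n) ≤ Φseq α n) × (Φseq α n ≤ 1ℚ - half^ (suc n))
  Φ-inv α zero = ≤-reflexive refl , ≤-reflexive refl
  Φ-inv α (suc n) with Φ-inv α n
  ... | lo , hi =
    subst (half^ (suc (suc n)) ≤_) (sym (Φ-step α n)) (stepLo (α n) (half^-nonneg (suc n)) lo) ,
    subst (_≤ 1ℚ - half^ (suc (suc n))) (sym (Φ-step α n)) (stepHi (α n) (half^-nonneg (suc n)) hi)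

  reg-eq : ∀ P r → P - (P + r) ≡ - r
  reg-eq = solve 2 (λ P r → P :- (P :+ r) := :- r) refl

  neg1-eq : ∀ q → q * - 1ℚ ≡ - q
  neg1-eq = solve 1 (λ q → q :* con (- 1ℚ) := :- q) refl

  Φ-reg : ∀ α n → ∣ Φseq α n - Φseq α (suc n) ∣ ≤ half^ (suc n)
  Φ-reg α n = ≤-trans (≤-reflexive e) (aux (α n))
    where
    h = half^ (suc n)
    h≥0 = half^-nonneg (suc n)
    q≥0 = ½h-nonneg h h≥0
    e : ∣ Φseq α n - Φseq α (suc n) ∣ ≡ ∣ ½ * h * digit (α n) ∣
    e = trans (cong (λ z → ∣ Φseq α n - z ∣) (Φ-step α n))
         (trans (cong ∣_∣ (reg-eq (Φseq α n) (½ * h * digit (α n)))) (∣-p∣≡∣p∣ (½ * h * digit (α n))))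
    aux : ∀ d → ∣ ½ * h * digit d ∣ ≤ h
    aux zero = ≤-trans (≤-reflexive (trans (cong ∣_∣ (neg1-eq (½ * h)))
                 (trans (∣-p∣≡∣p∣ (½ * h)) (0≤p⇒∣p∣≡p q≥0)))) (½h≤h h h≥0)
    aux (suc zero) = ≤-trans (≤-reflexive (cong ∣_∣ (*-zeroʳ (½ * h)))) h≥0
    aux (suc (suc zero)) = ≤-trans (≤-reflexive (trans (cong ∣_∣ (*-identityʳ (½ * h))) (0≤p⇒∣p∣≡p q≥0))) (½h≤h h h≥0)

  two*-nonneg : ∀ n → 0ℚ ≤ two * half^ n
  two*-nonneg n = ≤-trans (≤-reflexive (sym (*-zeroʳ two))) (*-monoˡ-≤-nonNeg two (half^-nonneg n))

  Φ-ge0 : ∀ α → constˢ 0ℚ ≤ˢ Φseq α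
  Φ-ge0 α n = ≤-trans (-nonneg≤ 0ℚ (Φseq α n) (≤-trans (half^-nonneg (suc n)) (proj₁ (Φ-inv α n))))
                      (two*-nonneg n)

  Φ-le1 : ∀ α → Φseq α ≤ˢ constˢ 1ℚ
  Φ-le1 α n = ≤-trans (+-monoˡ-≤ (- 1ℚ) (≤-trans (proj₂ (Φ-inv α n)) (-nonneg≤ 1ℚ _ (half^-nonneg (suc n)))))
                      (two*-nonneg n)

Φ : (ℕ → Fin 3) → I
Φ α = mkℝ (Φseq α) (Φ-reg α) , Φ-ge0 α , Φ-le1 α

IsTernaryModulus : (I → ℝ) → (ℕ → (ℕ → Fin 3) → ℕ) → Set
IsTernaryModulus f g =
  (k : ℕ) (α : ℕ → Fin 3) (x : I) →
  DistLe (val (Φ α)) (val x) (g k α) → DistLe (f (Φ α)) (f x) k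

IsPointwiseContinuous : ((ℕ → Fin 3) → ℕ) → Set
IsPointwiseContinuous F =
  (α : ℕ → Fin 3) → ∃[ n ] ((β : ℕ → Fin 3) → initSeg α n ≡ initSeg β n → F α ≡ F β)

IsContinuousTernaryModulus : (I → ℝ) → (ℕ → (ℕ → Fin 3) → ℕ) → Set
IsContinuousTernaryModulus f g =
  IsTernaryModulus f g × ((k : ℕ) → IsPointwiseContinuous (g k))

IsUniformlyContinuous : (I → ℝ) → Set
IsUniformlyContinuous f =
  Σ (ℕ → ℕ) λ ω → ((k : ℕ) (x y : I) → DistLe (val x) (val y) (ω k) → DistLe (f x) (f y) k)

UCTc' : Set
UCTc' = (f : I → ℝ) → Respects≃ f →
        Σ (ℕ → (ℕ → Fin 3) → ℕ) (IsContinuousTernaryModulus f) → IsUniformlyContinuous f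

-- Given a decidable bar B, place the binary words on a tree of nested,
-- well separated subintervals of [0,1] and let F be the sum of tents of
-- height 1 on the intervals of those words that are the first of their
-- branch in B.  To evaluate F at a real x, follow the branch selected by the
-- approximations of x until it meets B, which happens because B is a bar;
-- the depth of that meeting depends on finitely many approximations only, so
-- F has a continuous ternary modulus.  If F is uniformly continuous with
-- modulus ω, no branch can first meet B deeper than ω 2: the tent of such a
-- word takes the values 1 and 0 at two points of distance at most 2^-(ω 2).

module Submission where

open import Defs

open import Data.Bool using (Bool; true; false; not)
open import Data.Empty using (⊥-elim)
open import Data.List using (List; []; _∷ʳ_; foldl)
import Data.List.Properties as List
open import Data.Nat as ℕ using (ℕ; zero; suc; z≤n; s≤s)
import Data.Nat.Properties as ℕₚ
open import Data.Product using (∃; _×_; _,_; proj₁; proj₂)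
open import Data.Rational hiding (_≃_)
open import Data.Rational.Properties
open import Data.Rational.Solver using (module +-*-Solver)
open import Data.Sum using (inj₁; inj₂)
open import Function using (_∘_)
open import Relation.Binary.Definitions using (tri<; tri≈; tri>)
open import Relation.Binary.PropositionalEquality
open import Relation.Nullary using (Dec; yes; no; ¬_; does)
open +-*-Solver

+-nonNeg : ∀ {p q} → 0ℚ ≤ p → 0ℚ ≤ q → 0ℚ ≤ p + q
+-nonNeg 0≤p 0≤q = +-mono-≤ 0≤p 0≤q

*-nonNeg : ∀ {p q} → 0ℚ ≤ p → 0ℚ ≤ q → 0ℚ ≤ p * q
*-nonNeg {p} 0≤p 0≤q = ≤-trans (≤-reflexive (sym (*-zeroʳ p))) (*-monoˡ-≤-nonNeg p {{nonNegative 0≤p}} 0≤q)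

*-monoˡ-≤-0≤ : ∀ {r p q} → 0ℚ ≤ r → p ≤ q → r * p ≤ r * q
*-monoˡ-≤-0≤ {r} 0≤r = *-monoˡ-≤-nonNeg r {{nonNegative 0≤r}}

*-monoʳ-≤-0≤ : ∀ {r p q} → 0ℚ ≤ r → p ≤ q → p * r ≤ q * r
*-monoʳ-≤-0≤ {r} 0≤r = *-monoʳ-≤-nonNeg r {{nonNegative 0≤r}}

½*-nonNeg : ∀ {p} → 0ℚ ≤ p → 0ℚ ≤ ½ * p
½*-nonNeg = *-nonNeg (nonNegative⁻¹ ½)

½*-pos : ∀ {p} → 0ℚ < p → 0ℚ < ½ * p
½*-pos 0<p = ≤-<-trans (≤-reflexive (sym (*-zeroʳ ½))) (*-monoʳ-<-pos ½ 0<p)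

p≤q⇒0≤q-p : ∀ {p q} → p ≤ q → 0ℚ ≤ q - p
p≤q⇒0≤q-p {p} p≤q = ≤-trans (≤-reflexive (sym (+-inverseʳ p))) (+-monoˡ-≤ (- p) p≤q)

p<q⇒0<q-p : ∀ {p q} → p < q → 0ℚ < q - p
p<q⇒0<q-p {p} p<q = ≤-<-trans (≤-reflexive (sym (+-inverseʳ p))) (+-monoˡ-< (- p) p<q)

≤-by-difference : ∀ {p q} d → q - p ≡ d → 0ℚ ≤ d → p ≤ q
≤-by-difference {p} {q} d q-p≡d 0≤d = begin
  p            ≡⟨ +-identityʳ p ⟨
  p + 0ℚ       ≤⟨ +-monoʳ-≤ p 0≤d ⟩
  p + d        ≡⟨ cong (p +_) q-p≡d ⟨
  p + (q - p)  ≡⟨ solve 2 (λ p q → p :+ (q :- p) := q) refl p q ⟩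
  q            ∎
  where open ≤-Reasoning

<-by-difference : ∀ {p q} d → q - p ≡ d → 0ℚ < d → p < q
<-by-difference {p} {q} d q-p≡d 0<d = begin-strict
  p            ≡⟨ +-identityʳ p ⟨
  p + 0ℚ       <⟨ +-monoʳ-< p 0<d ⟩
  p + d        ≡⟨ cong (p +_) q-p≡d ⟨
  p + (q - p)  ≡⟨ solve 2 (λ p q → p :+ (q :- p) := q) refl p q ⟩
  q            ∎
  where open ≤-Reasoning

p≤q+r⇒p-r≤q : ∀ {p q r} → p ≤ q + r → p - r ≤ q
p≤q+r⇒p-r≤q {p} {q} {r} h = ≤-by-difference _
  (solve 3 (λ p q r → q :- (p :- r) := (q :+ r) :- p) refl p q r) (p≤q⇒0≤q-p h)

p-r≤q⇒p≤q+r : ∀ {p q r} → p - r ≤ q → p ≤ q + r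
p-r≤q⇒p≤q+r {p} {q} {r} h = ≤-by-difference _
  (solve 3 (λ p q r → (q :+ r) :- p := q :- (p :- r)) refl p q r) (p≤q⇒0≤q-p h)

p+q≤r⇒p≤r-q : ∀ {p q r} → p + q ≤ r → p ≤ r - q
p+q≤r⇒p≤r-q {p} {q} {r} h = ≤-by-difference _
  (solve 3 (λ p q r → (r :- q) :- p := r :- (p :+ q)) refl p q r) (p≤q⇒0≤q-p h)

neg-involutive : ∀ p → - - p ≡ p
neg-involutive = solve 1 (λ p → :- (:- p) := p) refl

-p≤∣p∣ : ∀ p → - p ≤ ∣ p ∣
p≤∣p∣ : ∀ p → p ≤ ∣ p ∣
p≤∣p∣ p with ∣p∣≡p∨∣p∣≡-p p
... | inj₁ ∣p∣≡p  = ≤-reflexive (sym ∣p∣≡p)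
... | inj₂ ∣p∣≡-p = ≤-by-difference (∣ p ∣ + ∣ p ∣)
  (trans (cong (λ q → ∣ p ∣ - q) p≡-∣p∣) (solve 1 (λ a → a :- (:- a) := a :+ a) refl ∣ p ∣))
  (+-nonNeg (0≤∣p∣ p) (0≤∣p∣ p))
  where
  p≡-∣p∣ : p ≡ - ∣ p ∣
  p≡-∣p∣ = trans (sym (neg-involutive p)) (cong -_ (sym ∣p∣≡-p))
-p≤∣p∣ p = ≤-trans (p≤∣p∣ (- p)) (≤-reflexive (∣-p∣≡∣p∣ p))

∣p∣≤q : ∀ {p q} → - q ≤ p → p ≤ q → ∣ p ∣ ≤ q
∣p∣≤q {p} {q} -q≤p p≤q with ∣p∣≡p∨∣p∣≡-p p
... | inj₁ ∣p∣≡p  = ≤-trans (≤-reflexive ∣p∣≡p) p≤q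
... | inj₂ ∣p∣≡-p = ≤-trans (≤-reflexive ∣p∣≡-p) (≤-trans (neg-antimono-≤ -q≤p) (≤-reflexive (neg-involutive q)))

∣p-q∣≡∣q-p∣ : ∀ p q → ∣ p - q ∣ ≡ ∣ q - p ∣
∣p-q∣≡∣q-p∣ p q = trans (cong ∣_∣ (solve 2 (λ p q → p :- q := :- (q :- p)) refl p q)) (∣-p∣≡∣p∣ (q - p))

∣p-r∣≤∣p-q∣+∣q-r∣ : ∀ p q r → ∣ p - r ∣ ≤ ∣ p - q ∣ + ∣ q - r ∣
∣p-r∣≤∣p-q∣+∣q-r∣ p q r = ≤-trans
  (≤-reflexive (cong ∣_∣ (solve 3 (λ p q r → p :- r := (p :- q) :+ (q :- r)) refl p q r)))
  (∣p+q∣≤∣p∣+∣q∣ (p - q) (q - r))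

∣p∣-∣q∣≤∣p-q∣ : ∀ p q → ∣ p ∣ - ∣ q ∣ ≤ ∣ p - q ∣
∣p∣-∣q∣≤∣p-q∣ p q = p≤q+r⇒p-r≤q (≤-trans
  (≤-reflexive (cong ∣_∣ (solve 2 (λ p q → p := (p :- q) :+ q) refl p q)))
  (∣p+q∣≤∣p∣+∣q∣ (p - q) q))

∣∣p∣-∣q∣∣≤∣p-q∣ : ∀ p q → ∣ ∣ p ∣ - ∣ q ∣ ∣ ≤ ∣ p - q ∣
∣∣p∣-∣q∣∣≤∣p-q∣ p q = ∣p∣≤q lower (∣p∣-∣q∣≤∣p-q∣ p q)
  where
  open ≤-Reasoning
  lower : - ∣ p - q ∣ ≤ ∣ p ∣ - ∣ q ∣
  lower = begin
    - ∣ p - q ∣          ≡⟨ cong -_ (∣p-q∣≡∣q-p∣ p q) ⟩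
    - ∣ q - p ∣          ≤⟨ neg-antimono-≤ (∣p∣-∣q∣≤∣p-q∣ q p) ⟩
    - (∣ q ∣ - ∣ p ∣)    ≡⟨ solve 2 (λ a b → :- (b :- a) := a :- b) refl ∣ p ∣ ∣ q ∣ ⟩
    ∣ p ∣ - ∣ q ∣        ∎

∣p∣≤∣p-q∣ : ∀ {p q} → 0ℚ ≤ p → q ≤ 0ℚ → ∣ p ∣ ≤ ∣ p - q ∣
∣p∣≤∣p-q∣ {p} {q} 0≤p q≤0 = begin
  ∣ p ∣       ≡⟨ 0≤p⇒∣p∣≡p 0≤p ⟩
  p           ≤⟨ ≤-by-difference (- q) (solve 2 (λ p q → (p :- q) :- p := :- q) refl p q) (neg-antimono-≤ q≤0) ⟩
  p - q       ≤⟨ p≤∣p∣ (p - q) ⟩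
  ∣ p - q ∣   ∎
  where open ≤-Reasoning

0⊔-nonexpansive : ∀ p q → ∣ (0ℚ ⊔ p) - (0ℚ ⊔ q) ∣ ≤ ∣ p - q ∣
0⊔-nonexpansive p q with ≤-total 0ℚ p | ≤-total 0ℚ q
... | inj₁ 0≤p | inj₁ 0≤q rewrite p≤q⇒p⊔q≡q 0≤p | p≤q⇒p⊔q≡q 0≤q = ≤-refl
... | inj₂ p≤0 | inj₂ q≤0 rewrite p≥q⇒p⊔q≡p p≤0 | p≥q⇒p⊔q≡p q≤0 = 0≤∣p∣ (p - q)
... | inj₁ 0≤p | inj₂ q≤0 rewrite p≤q⇒p⊔q≡q 0≤p | p≥q⇒p⊔q≡p q≤0 =
  ≤-trans (≤-reflexive (cong ∣_∣ (+-identityʳ p))) (∣p∣≤∣p-q∣ 0≤p q≤0)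
... | inj₂ p≤0 | inj₁ 0≤q rewrite p≥q⇒p⊔q≡p p≤0 | p≤q⇒p⊔q≡q 0≤q = begin
  ∣ 0ℚ - q ∣  ≡⟨ cong ∣_∣ (+-identityˡ (- q)) ⟩
  ∣ - q ∣     ≡⟨ ∣-p∣≡∣p∣ q ⟩
  ∣ q ∣       ≤⟨ ∣p∣≤∣p-q∣ 0≤q p≤0 ⟩
  ∣ q - p ∣   ≡⟨ ∣p-q∣≡∣q-p∣ q p ⟩
  ∣ p - q ∣   ∎
  where open ≤-Reasoning

two^ : ℕ → ℚ
two^ zero    = 1ℚ
two^ (suc k) = two * two^ k

0≤two : 0ℚ ≤ two
0≤two = nonNegative⁻¹ two

p≤two*p : ∀ {p} → 0ℚ ≤ p → p ≤ two * p
p≤two*p {p} = ≤-by-difference p (solve 1 (λ p → con two :* p :- p := p) refl p)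

½*p≤p : ∀ {p} → 0ℚ ≤ p → ½ * p ≤ p
½*p≤p {p} 0≤p = ≤-by-difference (½ * p) (solve 1 (λ p → p :- con ½ :* p := con ½ :* p) refl p) (½*-nonNeg 0≤p)

0≤two^ : ∀ k → 0ℚ ≤ two^ k
0≤two^ zero    = nonNegative⁻¹ 1ℚ
0≤two^ (suc k) = *-nonNeg 0≤two (0≤two^ k)

two^-mono-≤ : ∀ {m n} → m ℕ.≤ n → two^ m ≤ two^ n
two^-mono-≤ {zero}  {zero}  _         = ≤-refl
two^-mono-≤ {zero}  {suc n} _         = ≤-trans (two^-mono-≤ {zero} {n} z≤n) (p≤two*p (0≤two^ n))
two^-mono-≤ {suc m} {suc n} (s≤s m≤n) = *-monoˡ-≤-0≤ 0≤two (two^-mono-≤ m≤n)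

0<half^ : ∀ k → 0ℚ < half^ k
0<half^ zero    = positive⁻¹ 1ℚ
0<half^ (suc k) = ½*-pos (0<half^ k)

0≤half^ : ∀ k → 0ℚ ≤ half^ k
0≤half^ k = <⇒≤ (0<half^ k)

half^-suc≤half^ : ∀ k → half^ (suc k) ≤ half^ k
half^-suc≤half^ k = ½*p≤p (0≤half^ k)

half^-antimono-≤ : ∀ {m n} → m ℕ.≤ n → half^ n ≤ half^ m
half^-antimono-≤ {zero}  {zero}  _         = ≤-refl
half^-antimono-≤ {zero}  {suc n} _         = ≤-trans (half^-suc≤half^ n) (half^-antimono-≤ {zero} {n} z≤n)
half^-antimono-≤ {suc m} {suc n} (s≤s m≤n) = *-monoˡ-≤-0≤ (nonNegative⁻¹ ½) (half^-antimono-≤ m≤n)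

half^-suc+half^-suc : ∀ k → half^ (suc k) + half^ (suc k) ≡ half^ k
half^-suc+half^-suc k = solve 1 (λ h → con ½ :* h :+ con ½ :* h := h) refl (half^ k)

two*half^-suc : ∀ k → two * half^ (suc k) ≡ half^ k
two*half^-suc k = solve 1 (λ h → con two :* (con ½ :* h) := h) refl (half^ k)

two^*half^ : ∀ k j → two^ k * half^ (k ℕ.+ j) ≡ half^ j
two^*half^ zero    j = *-identityˡ (half^ j)
two^*half^ (suc k) j = trans
  (solve 2 (λ a b → (con two :* a) :* (con ½ :* b) := a :* b) refl (two^ k) (half^ (k ℕ.+ j)))
  (two^*half^ k j)

reg-telescope : ∀ (x : ℝ) m j → ∣ seq x m - seq x (j ℕ.+ m) ∣ ≤ half^ m - half^ (j ℕ.+ m)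
reg-telescope x m zero    = ≤-reflexive (trans (cong ∣_∣ (+-inverseʳ (seq x m))) (sym (+-inverseʳ (half^ m))))
reg-telescope x m (suc j) = begin
  ∣ seq x m - seq x (suc j ℕ.+ m) ∣
    ≤⟨ ∣p-r∣≤∣p-q∣+∣q-r∣ (seq x m) (seq x (j ℕ.+ m)) (seq x (suc j ℕ.+ m)) ⟩
  ∣ seq x m - seq x (j ℕ.+ m) ∣ + ∣ seq x (j ℕ.+ m) - seq x (suc j ℕ.+ m) ∣
    ≤⟨ +-mono-≤ (reg-telescope x m j) (reg x (j ℕ.+ m)) ⟩
  (half^ m - half^ (j ℕ.+ m)) + half^ (suc j ℕ.+ m)
    ≡⟨ solve 2 (λ a h → a :- h :+ con ½ :* h := a :- con ½ :* h) refl (half^ m) (half^ (j ℕ.+ m)) ⟩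
  half^ m - half^ (suc j ℕ.+ m) ∎
  where open ≤-Reasoning

reg-≤ : ∀ (x : ℝ) {m n} → m ℕ.≤ n → ∣ seq x m - seq x n ∣ ≤ half^ m
reg-≤ x {m} {n} m≤n = subst (λ k → ∣ seq x m - seq x k ∣ ≤ half^ m) (ℕₚ.m∸n+n≡m m≤n)
  (≤-trans (reg-telescope x m (n ℕ.∸ m))
    (≤-by-difference _ (solve 2 (λ a b → a :- (a :- b) := b) refl (half^ m) (half^ (n ℕ.∸ m ℕ.+ m)))
      (0≤half^ (n ℕ.∸ m ℕ.+ m))))

constℝ : ℚ → ℝ
constℝ p = mkℝ (λ _ → p) (λ n → ≤-trans (≤-reflexive (cong ∣_∣ (+-inverseʳ p))) (0≤half^ (suc n)))

module Least {P : ℕ → Set} (P? : ∀ n → Dec (P n)) where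

  -- The least k ∈ [i, f + i] satisfying P, or f + i if there is none.
  search : ℕ → ℕ → ℕ
  search i zero    = i
  search i (suc f) with P? i
  ... | yes _ = i
  ... | no  _ = search (suc i) f

  search-holds : ∀ i f → P (f ℕ.+ i) → P (search i f)
  search-holds i zero    p = p
  search-holds i (suc f) p with P? i
  ... | yes pᵢ = pᵢ
  ... | no  _  = search-holds (suc i) f (subst P (sym (ℕₚ.+-suc f i)) p)

  search-minimal : ∀ i f {k} → i ℕ.≤ k → k ℕ.< search i f → ¬ P k
  search-minimal i zero    i≤k k<i = ⊥-elim (ℕₚ.≤⇒≯ i≤k k<i)
  search-minimal i (suc f) i≤k k<s with P? i
  ... | yes _  = ⊥-elim (ℕₚ.≤⇒≯ i≤k k<s)
  ... | no  ¬p with ℕₚ.m≤n⇒m<n∨m≡n i≤k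
  ...   | inj₁ i<k  = search-minimal (suc i) f i<k k<s
  ...   | inj₂ refl = ¬p

  least : ∃ P → ℕ
  least (n , _) = search 0 n

  least-holds : ∀ w → P (least w)
  least-holds (n , p) = search-holds 0 n (subst P (sym (ℕₚ.+-identityʳ n)) p)

  least-minimal : ∀ w {k} → k ℕ.< least w → ¬ P k
  least-minimal (n , _) = search-minimal 0 n z≤n

  least-unique : ∀ w {m} → P m → (∀ {k} → k ℕ.< m → ¬ P k) → least w ≡ m
  least-unique w {m} pₘ m-least with ℕₚ.<-cmp (least w) m
  ... | tri< l<m _ _ = ⊥-elim (m-least l<m (least-holds w))
  ... | tri≈ _ l≡m _ = l≡m
  ... | tri> _ _ m<l = ⊥-elim (least-minimal w m<l pₘ)

-- The interval of a word at depth n has radius 2^-(3n+1); its two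
-- children sit at distance r/2 on either side of its centre and have
-- radius r/8, so sibling intervals are far apart.
radiusExp : ℕ → ℕ
radiusExp zero    = 1
radiusExp (suc n) = 3 ℕ.+ radiusExp n

radius : ℕ → ℚ
radius n = half^ (radiusExp n)

scale : ℕ → ℚ
scale n = two^ (radiusExp n)

scale*radius : ∀ n → scale n * radius n ≡ 1ℚ
scale*radius n = trans (cong (λ k → scale n * half^ k) (sym (ℕₚ.+-identityʳ (radiusExp n))))
                       (two^*half^ (radiusExp n) 0)

quarter eighth : ℚ → ℚ
quarter r = ½ * (½ * r)
eighth  r = ½ * quarter r

sign : Bool → ℚ
sign false = - 1ℚ
sign true  = 1ℚ

childCentre : ℚ → ℚ → Bool → ℚ
childCentre c r b = c + sign b * (½ * r)

descend : ℚ × ℕ → Bool → ℚ × ℕ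
descend (c , n) b = childCentre c (radius n) b , suc n

centre : List Bool → ℚ
centre t = proj₁ (foldl descend (½ , 0) t)

depth : List Bool → ℕ
depth t = proj₂ (foldl descend (½ , 0) t)

centre-∷ʳ : ∀ t b → centre (t ∷ʳ b) ≡ childCentre (centre t) (radius (depth t)) b
centre-∷ʳ t b = cong proj₁ (List.foldl-∷ʳ descend (½ , 0) b t)

depth-∷ʳ : ∀ t b → depth (t ∷ʳ b) ≡ suc (depth t)
depth-∷ʳ t b = cong proj₂ (List.foldl-∷ʳ descend (½ , 0) b t)

radius-∷ʳ : ∀ t b → radius (depth (t ∷ʳ b)) ≡ eighth (radius (depth t))
radius-∷ʳ t b = cong radius (depth-∷ʳ t b)

Inside Outside : List Bool → ℚ → Set
Inside  t p = ∣ p - centre t ∣ ≤ radius (depth t)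
Outside t p = radius (depth t) < ∣ p - centre t ∣

module _ {c r : ℚ} where

  ∣childCentre-c∣ : ∀ b → 0ℚ ≤ r → ∣ childCentre c r b - c ∣ ≡ ½ * r
  ∣childCentre-c∣ b 0≤r = trans (cong ∣_∣ (solve 2 (λ c d → (c :+ d) :- c := d) refl c (sign b * (½ * r))))
                                (∣sign*p∣ b (½*-nonNeg 0≤r))
    where
    ∣sign*p∣ : ∀ b {p} → 0ℚ ≤ p → ∣ sign b * p ∣ ≡ p
    ∣sign*p∣ false {p} 0≤p = trans (cong ∣_∣ (solve 1 (λ p → con (- 1ℚ) :* p := :- p) refl p))
                                   (trans (∣-p∣≡∣p∣ p) (0≤p⇒∣p∣≡p 0≤p))
    ∣sign*p∣ true  {p} 0≤p = trans (cong ∣_∣ (*-identityˡ p)) (0≤p⇒∣p∣≡p 0≤p)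

  ∣childCentre-sibling∣ : ∀ b → 0ℚ ≤ r → ∣ childCentre c r b - childCentre c r (not b) ∣ ≡ r
  ∣childCentre-sibling∣ false 0≤r = trans
    (cong ∣_∣ (solve 2 (λ c r → (c :+ con (- 1ℚ) :* (con ½ :* r)) :- (c :+ con 1ℚ :* (con ½ :* r)) := :- r) refl c r))
    (trans (∣-p∣≡∣p∣ r) (0≤p⇒∣p∣≡p 0≤r))
  ∣childCentre-sibling∣ true 0≤r = trans
    (cong ∣_∣ (solve 2 (λ c r → (c :+ con 1ℚ :* (con ½ :* r)) :- (c :+ con (- 1ℚ) :* (con ½ :* r)) := r) refl c r))
    (0≤p⇒∣p∣≡p 0≤r)

  eighth+½≤ : 0ℚ ≤ r → eighth r + ½ * r ≤ r
  eighth+½≤ 0≤r = ≤-by-difference (quarter r + eighth r)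
    (solve 1 (λ r → r :- (con ½ :* (con ½ :* (con ½ :* r)) :+ con ½ :* r)
                    := con ½ :* (con ½ :* r) :+ con ½ :* (con ½ :* (con ½ :* r))) refl r)
    (+-nonNeg (½*-nonNeg (½*-nonNeg 0≤r)) (½*-nonNeg (½*-nonNeg (½*-nonNeg 0≤r))))

  outside⇒outside-child : ∀ {p} b → 0ℚ ≤ r → r < ∣ p - c ∣ → eighth r < ∣ p - childCentre c r b ∣
  outside⇒outside-child {p} b 0≤r r<∣p-c∣ = begin-strict
    eighth r                 ≤⟨ p+q≤r⇒p≤r-q (eighth+½≤ 0≤r) ⟩
    r - ½ * r                <⟨ +-monoˡ-< (- (½ * r)) r<∣p-c∣ ⟩
    ∣ p - c ∣ - ½ * r         ≤⟨ p≤q+r⇒p-r≤q triangle ⟩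
    ∣ p - childCentre c r b ∣  ∎
    where
    open ≤-Reasoning
    triangle : ∣ p - c ∣ ≤ ∣ p - childCentre c r b ∣ + ½ * r
    triangle = ≤-trans (∣p-r∣≤∣p-q∣+∣q-r∣ p (childCentre c r b) c)
                       (≤-reflexive (cong (∣ p - childCentre c r b ∣ +_) (∣childCentre-c∣ b 0≤r)))

  inside-child⇒inside : ∀ {p} b → 0ℚ ≤ r → ∣ p - childCentre c r b ∣ ≤ eighth r → ∣ p - c ∣ ≤ r
  inside-child⇒inside {p} b 0≤r inside = begin
    ∣ p - c ∣                                         ≤⟨ ∣p-r∣≤∣p-q∣+∣q-r∣ p (childCentre c r b) c ⟩
    ∣ p - childCentre c r b ∣ + ∣ childCentre c r b - c ∣ ≤⟨ +-mono-≤ inside (≤-reflexive (∣childCentre-c∣ b 0≤r)) ⟩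
    eighth r + ½ * r                                  ≤⟨ eighth+½≤ 0≤r ⟩
    r                                                 ∎
    where open ≤-Reasoning

  inside-child⇒outside-sibling : ∀ {p} b → 0ℚ < r → ∣ p - childCentre c r b ∣ ≤ eighth r →
                                 eighth r < ∣ p - childCentre c r (not b) ∣
  inside-child⇒outside-sibling {p} b 0<r inside = begin-strict
    eighth r     <⟨ <-by-difference (½ * r + quarter r)
                      (solve 1 (λ r → (r :- con ½ :* (con ½ :* (con ½ :* r))) :- con ½ :* (con ½ :* (con ½ :* r))
                                      := con ½ :* r :+ con ½ :* (con ½ :* r)) refl r)
                      (+-mono-<-≤ (½*-pos 0<r) (½*-nonNeg (½*-nonNeg (<⇒≤ 0<r)))) ⟩
    r - eighth r  ≤⟨ p≤q+r⇒p-r≤q triangle ⟩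
    ∣ p - c″ ∣     ∎
    where
    open ≤-Reasoning
    c′ c″ : ℚ
    c′ = childCentre c r b
    c″ = childCentre c r (not b)
    triangle : r ≤ ∣ p - c″ ∣ + eighth r
    triangle = begin
      r                        ≡⟨ ∣childCentre-sibling∣ b (<⇒≤ 0<r) ⟨
      ∣ c′ - c″ ∣               ≤⟨ ∣p-r∣≤∣p-q∣+∣q-r∣ c′ p c″ ⟩
      ∣ c′ - p ∣ + ∣ p - c″ ∣    ≡⟨ cong (_+ ∣ p - c″ ∣) (∣p-q∣≡∣q-p∣ c′ p) ⟩
      ∣ p - c′ ∣ + ∣ p - c″ ∣    ≤⟨ +-monoˡ-≤ ∣ p - c″ ∣ inside ⟩
      eighth r + ∣ p - c″ ∣      ≡⟨ +-comm (eighth r) ∣ p - c″ ∣ ⟩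
      ∣ p - c″ ∣ + eighth r      ∎

  near-point⇒outside-other-child : ∀ {p x} (c≤?x : Dec (c ≤ x)) → 0ℚ < r → ∣ p - x ∣ ≤ quarter r →
                                  eighth r < ∣ p - childCentre c r (not (does c≤?x)) ∣
  near-point⇒outside-other-child {p} {x} (yes c≤x) 0<r ∣p-x∣≤ = begin-strict
    eighth r                      <⟨ <-by-difference ((quarter r - (x - p)) + (x - c) + eighth r)
                                       (solve 4 (λ c r p x → (p :- (c :+ con (- 1ℚ) :* (con ½ :* r))) :- con ½ :* (con ½ :* (con ½ :* r))
                                                 := (con ½ :* (con ½ :* r) :- (x :- p)) :+ (x :- c) :+ con ½ :* (con ½ :* (con ½ :* r))) refl c r p x)
                                       (+-mono-≤-< (+-nonNeg (p≤q⇒0≤q-p x-p≤) (p≤q⇒0≤q-p c≤x)) 0<eighth) ⟩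
    p - childCentre c r false      ≤⟨ p≤∣p∣ _ ⟩
    ∣ p - childCentre c r false ∣  ∎
    where
    open ≤-Reasoning
    x-p≤ : x - p ≤ quarter r
    x-p≤ = ≤-trans (p≤∣p∣ (x - p)) (≤-trans (≤-reflexive (∣p-q∣≡∣q-p∣ x p)) ∣p-x∣≤)
    0<eighth : 0ℚ < eighth r
    0<eighth = ½*-pos (½*-pos (½*-pos 0<r))
  near-point⇒outside-other-child {p} {x} (no c≰x) 0<r ∣p-x∣≤ = begin-strict
    eighth r                      <⟨ <-by-difference ((quarter r - (p - x)) + (c - x) + eighth r)
                                       (solve 4 (λ c r p x → (:- (p :- (c :+ con 1ℚ :* (con ½ :* r)))) :- con ½ :* (con ½ :* (con ½ :* r))
                                                 := (con ½ :* (con ½ :* r) :- (p :- x)) :+ (c :- x) :+ con ½ :* (con ½ :* (con ½ :* r))) refl c r p x)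
                                       (+-mono-≤-< (+-nonNeg (p≤q⇒0≤q-p p-x≤) (<⇒≤ (p<q⇒0<q-p (≰⇒> c≰x)))) 0<eighth) ⟩
    - (p - childCentre c r true)   ≤⟨ -p≤∣p∣ _ ⟩
    ∣ p - childCentre c r true ∣   ∎
    where
    open ≤-Reasoning
    p-x≤ : p - x ≤ quarter r
    p-x≤ = ≤-trans (p≤∣p∣ (p - x)) ∣p-x∣≤
    0<eighth : 0ℚ < eighth r
    0<eighth = ½*-pos (½*-pos (½*-pos 0<r))

module _ (t : List Bool) (b : Bool) (p : ℚ) where

  private
    r : ℚ
    r = radius (depth t)

    unfold-inside : Inside (t ∷ʳ b) p → ∣ p - childCentre (centre t) r b ∣ ≤ eighth r
    unfold-inside = subst₂ _≤_ (cong (λ c → ∣ p - c ∣) (centre-∷ʳ t b)) (radius-∷ʳ t b)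

    0<r : 0ℚ < r
    0<r = 0<half^ (radiusExp (depth t))

    fold-outside : ∀ {b} → eighth r < ∣ p - childCentre (centre t) r b ∣ → Outside (t ∷ʳ b) p
    fold-outside {b} = subst₂ _<_ (sym (radius-∷ʳ t b)) (cong (λ c → ∣ p - c ∣) (sym (centre-∷ʳ t b)))

  outside-∷ʳ : Outside t p → Outside (t ∷ʳ b) p
  outside-∷ʳ o = fold-outside (outside⇒outside-child {c = centre t} {p = p} b (<⇒≤ 0<r) o)

  inside-∷ʳ⇒inside : Inside (t ∷ʳ b) p → Inside t p
  inside-∷ʳ⇒inside i = inside-child⇒inside {c = centre t} {p = p} b (<⇒≤ 0<r) (unfold-inside i)

  inside-∷ʳ⇒outside-sibling : Inside (t ∷ʳ b) p → Outside (t ∷ʳ not b) p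
  inside-∷ʳ⇒outside-sibling i = fold-outside (inside-child⇒outside-sibling {c = centre t} {p = p} b 0<r (unfold-inside i))

  outside-other-child : ∀ {x} (c≤?x : Dec (centre t ≤ x)) → b ≡ does c≤?x → ∣ p - x ∣ ≤ quarter r →
                        Outside (t ∷ʳ not b) p
  outside-other-child c≤?x refl ∣p-x∣≤ = fold-outside (near-point⇒outside-other-child {p = p} c≤?x 0<r ∣p-x∣≤)

tent : List Bool → ℚ → ℚ
tent t p = 0ℚ ⊔ (1ℚ - scale (depth t) * ∣ p - centre t ∣)

0≤scale : ∀ n → 0ℚ ≤ scale n
0≤scale n = 0≤two^ (radiusExp n)

tent-lipschitz : ∀ t p q → ∣ tent t p - tent t q ∣ ≤ scale (depth t) * ∣ p - q ∣
tent-lipschitz t p q = begin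
  ∣ tent t p - tent t q ∣                  ≤⟨ 0⊔-nonexpansive (1ℚ - s * ∣ p - c ∣) (1ℚ - s * ∣ q - c ∣) ⟩
  ∣ (1ℚ - s * ∣ p - c ∣) - (1ℚ - s * ∣ q - c ∣) ∣
      ≡⟨ cong ∣_∣ (solve 3 (λ s a b → (con 1ℚ :- s :* a) :- (con 1ℚ :- s :* b) := s :* (b :- a)) refl s ∣ p - c ∣ ∣ q - c ∣) ⟩
  ∣ s * (∣ q - c ∣ - ∣ p - c ∣) ∣           ≡⟨ ∣p*q∣≡∣p∣*∣q∣ s _ ⟩
  ∣ s ∣ * ∣ ∣ q - c ∣ - ∣ p - c ∣ ∣          ≡⟨ cong (_* ∣ ∣ q - c ∣ - ∣ p - c ∣ ∣) (0≤p⇒∣p∣≡p (0≤scale (depth t))) ⟩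
  s * ∣ ∣ q - c ∣ - ∣ p - c ∣ ∣              ≤⟨ *-monoˡ-≤-0≤ (0≤scale (depth t)) (∣∣p∣-∣q∣∣≤∣p-q∣ (q - c) (p - c)) ⟩
  s * ∣ (q - c) - (p - c) ∣                 ≡⟨ cong (λ d → s * ∣ d ∣) (solve 3 (λ p q c → (q :- c) :- (p :- c) := q :- p) refl p q c) ⟩
  s * ∣ q - p ∣                             ≡⟨ cong (s *_) (∣p-q∣≡∣q-p∣ q p) ⟩
  s * ∣ p - q ∣                             ∎
  where
  open ≤-Reasoning
  s c : ℚ
  s = scale (depth t)
  c = centre t

tent-vanishes : ∀ t {p} → radius (depth t) ≤ ∣ p - centre t ∣ → tent t p ≡ 0ℚ
tent-vanishes t {p} r≤d = p≥q⇒p⊔q≡p {q = 1ℚ - s * d} (≤-by-difference (s * d - 1ℚ)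
  (solve 2 (λ s d → con 0ℚ :- (con 1ℚ :- s :* d) := s :* d :- con 1ℚ) refl s d)
  (p≤q⇒0≤q-p 1≤s*d))
  where
  open ≤-Reasoning
  s d : ℚ
  s = scale (depth t)
  d = ∣ p - centre t ∣
  1≤s*d : 1ℚ ≤ s * d
  1≤s*d = begin
    1ℚ                     ≡⟨ scale*radius (depth t) ⟨
    s * radius (depth t)   ≤⟨ *-monoˡ-≤-0≤ (0≤scale (depth t)) r≤d ⟩
    s * d                  ∎

tent-centre : ∀ t → tent t (centre t) ≡ 1ℚ
tent-centre t = cong (λ d → 0ℚ ⊔ (1ℚ - d))
  (trans (cong (λ d → scale (depth t) * ∣ d ∣) (+-inverseʳ (centre t))) (*-zeroʳ (scale (depth t))))

inside-root⇒I : ∀ p → Inside [] p → I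
inside-root⇒I p inside = constℝ p , (λ n → ≤-trans 0-p≤0 (0≤two*half^ n)) , (λ n → ≤-trans p-1≤0 (0≤two*half^ n))
  where
  0≤two*half^ : ∀ n → 0ℚ ≤ two * half^ n
  0≤two*half^ n = *-nonNeg 0≤two (0≤half^ n)
  0-p≤0 : 0ℚ - p ≤ 0ℚ
  0-p≤0 = ≤-by-difference _ (solve 1 (λ p → con 0ℚ :- (con 0ℚ :- p) := con (radius 0) :- (:- (p :- con ½))) refl p)
                            (p≤q⇒0≤q-p (≤-trans (-p≤∣p∣ (p - ½)) inside))
  p-1≤0 : p - 1ℚ ≤ 0ℚ
  p-1≤0 = ≤-by-difference _ (solve 1 (λ p → con 0ℚ :- (p :- con 1ℚ) := con (radius 0) :- (p :- con ½)) refl p)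
                            (p≤q⇒0≤q-p (≤-trans (p≤∣p∣ (p - ½)) inside))

initSeg-prefix : ∀ {A : Set} (α β : ℕ → A) {m n} → m ℕ.≤ n → initSeg α n ≡ initSeg β n → initSeg α m ≡ initSeg β m
initSeg-prefix α β {n = zero}  z≤n e = e
initSeg-prefix α β {n = suc n} m≤n e with ℕₚ.m≤n⇒m<n∨m≡n m≤n
... | inj₁ m<n  = initSeg-prefix α β (ℕₚ.≤-pred m<n) (proj₁ (List.∷ʳ-injective (initSeg α n) (initSeg β n) e))
... | inj₂ refl = e

Nᾱ-local : ∀ α β n → initSeg α n ≡ initSeg β n → Nᾱ α n ≡ Nᾱ β n
Nᾱ-local α β zero    _ = refl
Nᾱ-local α β (suc n) e with List.∷ʳ-injective (initSeg α n) (initSeg β n) e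
... | eₙ , αₙ≡βₙ = cong₂ (λ N i → two * N + digit i) (Nᾱ-local α β n eₙ) αₙ≡βₙ

Φseq-local : ∀ α β n → initSeg α n ≡ initSeg β n → Φseq α n ≡ Φseq β n
Φseq-local α β n e = cong (half^ (suc n) *_) (Nᾱ-local α β n e)

radiusExp-mono-≤ : ∀ {m n} → m ℕ.≤ n → radiusExp m ℕ.≤ radiusExp n
radiusExp-mono-≤ {zero}  {zero}  _         = ℕₚ.≤-refl
radiusExp-mono-≤ {zero}  {suc n} _         = ℕₚ.≤-trans (radiusExp-mono-≤ {zero} {n} z≤n) (ℕₚ.m≤n+m _ 3)
radiusExp-mono-≤ {suc m} {suc n} (s≤s m≤n) = ℕₚ.+-monoʳ-≤ 3 (radiusExp-mono-≤ m≤n)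

n≤radiusExp : ∀ n → n ℕ.≤ radiusExp n
n≤radiusExp zero    = z≤n
n≤radiusExp (suc n) = s≤s (ℕₚ.≤-trans (n≤radiusExp n) (ℕₚ.m≤n+m _ 2))

-- At depth n the path consults an approximation accurate to radius n / 16.
probe : ℕ → ℕ
probe n = 4 ℕ.+ radiusExp n

probe-mono-≤ : ∀ {m n} → m ℕ.≤ n → probe m ℕ.≤ probe n
probe-mono-≤ m≤n = ℕₚ.+-monoʳ-≤ 4 (radiusExp-mono-≤ m≤n)

branch : ℚ → ℚ → Bool
branch c x = does (c ≤? x)

path : (ℕ → ℚ) → ℕ → List Bool
path xs zero    = []
path xs (suc n) = path xs n ∷ʳ branch (centre (path xs n)) (xs (probe n))

pathBit : (ℕ → ℚ) → ℕ → Bool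
pathBit xs n = branch (centre (path xs n)) (xs (probe n))

initSeg-pathBit : ∀ xs n → initSeg (pathBit xs) n ≡ path xs n
initSeg-pathBit xs zero    = refl
initSeg-pathBit xs (suc n) = cong (_∷ʳ pathBit xs n) (initSeg-pathBit xs n)

depth-initSeg : ∀ (a : ℕ → Bool) n → depth (initSeg a n) ≡ n
depth-initSeg a zero    = refl
depth-initSeg a (suc n) = trans (depth-∷ʳ (initSeg a n) (a n)) (cong suc (depth-initSeg a n))

depth-path : ∀ xs n → depth (path xs n) ≡ n
depth-path xs n = trans (cong depth (sym (initSeg-pathBit xs n))) (depth-initSeg (pathBit xs) n)

path-local : ∀ xs ys n → (∀ {j} → j ℕ.< n → xs (probe j) ≡ ys (probe j)) → path xs n ≡ path ys n
path-local xs ys zero    _     = refl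
path-local xs ys (suc n) agree = cong₂ (λ t x → t ∷ʳ branch (centre t) x)
  (path-local xs ys n (λ j<n → agree (ℕₚ.m<n⇒m<1+n j<n))) (agree ℕₚ.≤-refl)

lipExp : ℕ → ℕ → ℕ
lipExp n zero    = 0
lipExp n (suc d) = suc (radiusExp n ℕ.⊔ lipExp (suc n) d)

module TentSum {B : List Bool → Set} (B? : IsDecidable B) where

  tentSum : ℕ → List Bool → ℚ → ℚ
  tentSum zero    t p = 0ℚ
  tentSum (suc d) t p with B? t
  ... | yes _ = tent t p
  ... | no  _ = tentSum d (t ∷ʳ false) p + tentSum d (t ∷ʳ true) p

  tentSum-lipschitz : ∀ d t p q → ∣ tentSum d t p - tentSum d t q ∣ ≤ two^ (lipExp (depth t) d) * ∣ p - q ∣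
  tentSum-lipschitz zero    t p q = *-nonNeg (0≤two^ 0) (0≤∣p∣ (p - q))
  tentSum-lipschitz (suc d) t p q with B? t
  ... | yes _ = ≤-trans (tent-lipschitz t p q)
    (*-monoʳ-≤-0≤ (0≤∣p∣ (p - q)) (two^-mono-≤ (ℕₚ.≤-trans (ℕₚ.m≤m⊔n (radiusExp (depth t)) (lipExp (suc (depth t)) d)) (ℕₚ.n≤1+n _))))
  ... | no  _ = begin
    ∣ (f₀ p + f₁ p) - (f₀ q + f₁ q) ∣        ≡⟨ cong ∣_∣ (solve 4 (λ a b c d → (a :+ b) :- (c :+ d) := (a :- c) :+ (b :- d)) refl (f₀ p) (f₁ p) (f₀ q) (f₁ q)) ⟩
    ∣ (f₀ p - f₀ q) + (f₁ p - f₁ q) ∣        ≤⟨ ∣p+q∣≤∣p∣+∣q∣ (f₀ p - f₀ q) (f₁ p - f₁ q) ⟩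
    ∣ f₀ p - f₀ q ∣ + ∣ f₁ p - f₁ q ∣         ≤⟨ +-mono-≤ (child false) (child true) ⟩
    L * δ + L * δ                          ≡⟨ solve 2 (λ L δ → L :* δ :+ L :* δ := con two :* L :* δ) refl L δ ⟩
    two * L * δ                            ≤⟨ *-monoʳ-≤-0≤ (0≤∣p∣ (p - q)) (*-monoˡ-≤-0≤ 0≤two (two^-mono-≤ (ℕₚ.m≤n⊔m (radiusExp (depth t)) (lipExp (suc (depth t)) d)))) ⟩
    two^ (lipExp (depth t) (suc d)) * δ    ∎
    where
    open ≤-Reasoning
    f₀ f₁ : ℚ → ℚ
    f₀ = tentSum d (t ∷ʳ false)
    f₁ = tentSum d (t ∷ʳ true)
    L δ : ℚ
    L = two^ (lipExp (suc (depth t)) d)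
    δ = ∣ p - q ∣
    child : ∀ b → ∣ tentSum d (t ∷ʳ b) p - tentSum d (t ∷ʳ b) q ∣ ≤ L * δ
    child b = subst (λ n → ∣ tentSum d (t ∷ʳ b) p - tentSum d (t ∷ʳ b) q ∣ ≤ two^ (lipExp n d) * δ)
                    (depth-∷ʳ t b) (tentSum-lipschitz d (t ∷ʳ b) p q)

  tentSum-outside : ∀ d t p → Outside t p → tentSum d t p ≡ 0ℚ
  tentSum-outside zero    t p o = refl
  tentSum-outside (suc d) t p o with B? t
  ... | yes _ = tent-vanishes t {p} (<⇒≤ o)
  ... | no  _ = cong₂ _+_ (tentSum-outside d (t ∷ʳ false) p (outside-∷ʳ t false p o))
                          (tentSum-outside d (t ∷ʳ true) p (outside-∷ʳ t true p o))

  -- Searching d levels below t already determines tentSum at p.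
  data Settled : ℕ → List Bool → ℚ → Set where
    outside : ∀ {d t p} → Outside t p → Settled d t p
    barred  : ∀ {d t p} → B t → Settled (suc d) t p
    split   : ∀ {d t p} → Settled d (t ∷ʳ false) p → Settled d (t ∷ʳ true) p → Settled (suc d) t p

  settled-∷ʳ : ∀ {d t p} b → Settled d (t ∷ʳ b) p → Outside (t ∷ʳ not b) p → Settled (suc d) t p
  settled-∷ʳ false s o = split s (outside o)
  settled-∷ʳ true  s o = split (outside o) s

  tentSum-settled : ∀ {d t p} → Settled d t p → ∀ {e} → d ℕ.≤ e → tentSum d t p ≡ tentSum e t p
  tentSum-settled {d} {t} {p} (outside o) {e} _ = trans (tentSum-outside d t p o) (sym (tentSum-outside e t p o))
  tentSum-settled {suc d} {t} (barred b) {suc e} _ with B? t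
  ... | yes _  = refl
  ... | no  ¬b = ⊥-elim (¬b b)
  tentSum-settled {suc d} {t} (split s₀ s₁) {suc e} (s≤s d≤e) with B? t
  ... | yes _ = refl
  ... | no  _ = cong₂ _+_ (tentSum-settled s₀ d≤e) (tentSum-settled s₁ d≤e)

  tentSum-settled₂ : ∀ {d e t p} → Settled d t p → Settled e t p → tentSum d t p ≡ tentSum e t p
  tentSum-settled₂ {d} {e} s s′ = trans (tentSum-settled s (ℕₚ.m≤m⊔n d e)) (sym (tentSum-settled s′ (ℕₚ.m≤n⊔m d e)))

  settled-path : ∀ xs p {d} → B (path xs d) →
                 (∀ {n} → n ℕ.≤ d → ∣ p - xs (probe n) ∣ ≤ quarter (radius n)) → Settled (suc d) [] p
  settled-path xs p {d} hit close = below d (ℕₚ.+-identityʳ d)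
    where
    below : ∀ j {n} → j ℕ.+ n ≡ d → Settled (suc j) (path xs n) p
    below zero    e = barred (subst (λ n → B (path xs n)) (sym e) hit)
    below (suc j) {n} e = settled-∷ʳ (pathBit xs n) (below j (trans (ℕₚ.+-suc j n) e))
      (outside-other-child (path xs n) (pathBit xs n) p (centre (path xs n) ≤? xs (probe n)) refl close′)
      where
      close′ : ∣ p - xs (probe n) ∣ ≤ quarter (radius (depth (path xs n)))
      close′ = subst (λ m → ∣ p - xs (probe n) ∣ ≤ quarter (radius m)) (sym (depth-path xs n))
                     (close (subst (n ℕ.≤_) e (ℕₚ.m≤n+m n (suc j))))

  settled-near : ∀ (x : ℝ) {d M} p → B (path (seq x) d) → probe d ℕ.≤ M →
                 ∣ p - seq x M ∣ ≤ half^ (probe d) → Settled (suc d) [] p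
  settled-near x {d} {M} p hit d≤M close = settled-path (seq x) p hit close′
    where
    close′ : ∀ {n} → n ℕ.≤ d → ∣ p - seq x (probe n) ∣ ≤ quarter (radius n)
    close′ {n} n≤d = begin
      ∣ p - seq x (probe n) ∣
        ≤⟨ ∣p-r∣≤∣p-q∣+∣q-r∣ p (seq x M) (seq x (probe n)) ⟩
      ∣ p - seq x M ∣ + ∣ seq x M - seq x (probe n) ∣
        ≤⟨ +-mono-≤ (≤-trans close (half^-antimono-≤ (probe-mono-≤ n≤d)))
                    (≤-trans (≤-reflexive (∣p-q∣≡∣q-p∣ (seq x M) (seq x (probe n))))
                             (reg-≤ x (ℕₚ.≤-trans (probe-mono-≤ n≤d) d≤M))) ⟩
      half^ (probe n) + half^ (probe n)
        ≡⟨ half^-suc+half^-suc (3 ℕ.+ radiusExp n) ⟩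
      half^ (3 ℕ.+ radiusExp n)
        ≤⟨ half^-suc≤half^ (2 ℕ.+ radiusExp n) ⟩
      quarter (radius n) ∎
      where open ≤-Reasoning

  tentSum-children : ∀ {d t p v} b → tentSum d (t ∷ʳ b) p ≡ v → tentSum d (t ∷ʳ not b) p ≡ 0ℚ →
                     tentSum d (t ∷ʳ false) p + tentSum d (t ∷ʳ true) p ≡ v
  tentSum-children {v = v} false e e′ = trans (cong₂ _+_ e e′) (+-identityʳ v)
  tentSum-children {v = v} true  e e′ = trans (cong₂ _+_ e′ e) (+-identityˡ v)

  module FirstPrefix (a : ℕ → Bool) {L} (first : B (initSeg a L)) (before : ∀ {k} → k ℕ.< L → ¬ B (initSeg a k))
                     (r : ℚ) (inside : Inside (initSeg a L) r) where

    inside-above : ∀ j {i} → j ℕ.+ i ≡ L → Inside (initSeg a i) r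
    inside-above zero    e = subst (λ n → Inside (initSeg a n) r) (sym e) inside
    inside-above (suc j) {i} e = inside-∷ʳ⇒inside (initSeg a i) (a i) r (inside-above j (trans (ℕₚ.+-suc j i) e))

    settled-above : ∀ j {i} → j ℕ.+ i ≡ L → Settled (suc j) (initSeg a i) r
    settled-above zero    e = barred (subst (λ n → B (initSeg a n)) (sym e) first)
    settled-above (suc j) {i} e = settled-∷ʳ (a i) (settled-above j e′)
      (inside-∷ʳ⇒outside-sibling (initSeg a i) (a i) r (inside-above j e′))
      where e′ = trans (ℕₚ.+-suc j i) e

    tentSum-above : ∀ j {i} → j ℕ.+ i ≡ L → tentSum (suc j) (initSeg a i) r ≡ tent (initSeg a L) r
    tentSum-above zero {i} e with B? (initSeg a i)
    ... | yes _  = cong (λ n → tent (initSeg a n) r) e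
    ... | no  ¬b = ⊥-elim (¬b (subst (λ n → B (initSeg a n)) (sym e) first))
    tentSum-above (suc j) {i} e with B? (initSeg a i)
    ... | yes b = ⊥-elim (before (subst (i ℕ.<_) e (ℕₚ.m<n+m i (s≤s z≤n))) b)
    ... | no  _ = tentSum-children {suc j} {initSeg a i} {r} (a i) (tentSum-above j e′)
      (tentSum-outside (suc j) (initSeg a i ∷ʳ not (a i)) r (inside-∷ʳ⇒outside-sibling (initSeg a i) (a i) r (inside-above j e′)))
      where e′ = trans (ℕₚ.+-suc j i) e

module BarFunction {B : List Bool → Set} (B? : IsDecidable B) (bar : IsBar B) where
  open TentSum B?

  firstHit : (ℕ → Bool) → ℕ
  firstHit a = Least.least (λ n → B? (initSeg a n)) (bar a)

  firstHit-holds : ∀ a → B (initSeg a (firstHit a))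
  firstHit-holds a = Least.least-holds (λ n → B? (initSeg a n)) (bar a)

  firstHit-minimal : ∀ a {k} → k ℕ.< firstHit a → ¬ B (initSeg a k)
  firstHit-minimal a = Least.least-minimal (λ n → B? (initSeg a n)) (bar a)

  firstHit-unique : ∀ a {m} → B (initSeg a m) → (∀ {k} → k ℕ.< m → ¬ B (initSeg a k)) → firstHit a ≡ m
  firstHit-unique a = Least.least-unique (λ n → B? (initSeg a n)) (bar a)

  hitDepth : ℝ → ℕ
  hitDepth x = firstHit (pathBit (seq x))

  hitDepth-holds : ∀ x → B (path (seq x) (hitDepth x))
  hitDepth-holds x = subst B (initSeg-pathBit (seq x) (hitDepth x)) (firstHit-holds (pathBit (seq x)))

  hitDepth-local : ∀ x y → (∀ {j} → j ℕ.< hitDepth x → seq x (probe j) ≡ seq y (probe j)) → hitDepth y ≡ hitDepth x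
  hitDepth-local x y agree = firstHit-unique (pathBit (seq y))
    (subst B (same ℕₚ.≤-refl) (firstHit-holds (pathBit (seq x))))
    (λ k<L b → firstHit-minimal (pathBit (seq x)) k<L (subst B (sym (same (ℕₚ.<⇒≤ k<L))) b))
    where
    same : ∀ {i} → i ℕ.≤ hitDepth x → initSeg (pathBit (seq x)) i ≡ initSeg (pathBit (seq y)) i
    same {i} i≤L = begin
      initSeg (pathBit (seq x)) i  ≡⟨ initSeg-pathBit (seq x) i ⟩
      path (seq x) i               ≡⟨ path-local (seq x) (seq y) i (λ j<i → agree (ℕₚ.<-≤-trans j<i i≤L)) ⟩
      path (seq y) i               ≡⟨ initSeg-pathBit (seq y) i ⟨
      initSeg (pathBit (seq y)) i  ∎
      where open ≡-Reasoning

  -- F x evaluates the tent sum down to the first hit of x, which is Lipschitz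
  -- with constant 2^lipExpOf x, at an approximation of x precise enough to
  -- absorb that constant.
  lipExpOf : ℝ → ℕ
  lipExpOf x = lipExp 0 (suc (hitDepth x))

  tentSumOf : ℝ → ℚ → ℚ
  tentSumOf x = tentSum (suc (hitDepth x)) []

  index : ℝ → ℕ → ℕ
  index x n = lipExpOf x ℕ.+ (2 ℕ.+ n)

  Fseq : ℝ → ℕ → ℚ
  Fseq x n = tentSumOf x (seq x (index x n))

  Fseq-approx : ∀ x n {M} → index x n ℕ.≤ M → ∣ Fseq x n - tentSumOf x (seq x M) ∣ ≤ half^ (2 ℕ.+ n)
  Fseq-approx x n index≤M = begin
    ∣ Fseq x n - tentSumOf x (seq x _) ∣                         ≤⟨ tentSum-lipschitz (suc (hitDepth x)) [] _ _ ⟩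
    two^ (lipExpOf x) * ∣ seq x (index x n) - seq x _ ∣           ≤⟨ *-monoˡ-≤-0≤ (0≤two^ (lipExpOf x)) (reg-≤ x index≤M) ⟩
    two^ (lipExpOf x) * half^ (lipExpOf x ℕ.+ (2 ℕ.+ n))         ≡⟨ two^*half^ (lipExpOf x) (2 ℕ.+ n) ⟩
    half^ (2 ℕ.+ n)                                             ∎
    where open ≤-Reasoning

  Fseq-reg : ∀ x n → ∣ Fseq x n - Fseq x (suc n) ∣ ≤ half^ (suc n)
  Fseq-reg x n = ≤-trans (Fseq-approx x n (ℕₚ.+-monoʳ-≤ (lipExpOf x) (ℕₚ.n≤1+n (2 ℕ.+ n))))
                         (half^-suc≤half^ (suc n))

  F : ℝ → ℝ
  F x = mkℝ (Fseq x) (Fseq-reg x)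

  -- Approximations of x from index threshold x n on are precise enough
  -- both for Fseq x n and for the path of x down to its first hit.
  threshold : ℝ → ℕ → ℕ
  threshold x n = index x n ℕ.⊔ probe (hitDepth x)

  jointThreshold : ℝ → ℝ → ℕ → ℕ
  jointThreshold x y n = threshold x n ℕ.⊔ threshold y n

  tentSumOf-agree : ∀ x y {M} → probe (hitDepth x) ℕ.≤ M → probe (hitDepth y) ℕ.≤ M →
                    ∣ seq x M - seq y M ∣ ≤ half^ (probe (hitDepth x)) → tentSumOf x (seq y M) ≡ tentSumOf y (seq y M)
  tentSumOf-agree x y {M} px py close = tentSum-settled₂
    (settled-near x (seq y M) (hitDepth-holds x) px (≤-trans (≤-reflexive (∣p-q∣≡∣q-p∣ (seq y M) (seq x M))) close))
    (settled-near y (seq y M) (hitDepth-holds y) py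
      (≤-trans (≤-reflexive (cong ∣_∣ (+-inverseʳ (seq y M)))) (0≤half^ (probe (hitDepth y)))))

  Fseq-close : ∀ x y n {M ε} → jointThreshold x y n ℕ.≤ M →
               ∣ seq x M - seq y M ∣ ≤ ε → ε ≤ half^ (probe (hitDepth x)) →
               ∣ Fseq x n - Fseq y n ∣ ≤ half^ (suc n) + two^ (lipExpOf x) * ε
  Fseq-close x y n {M} {ε} late δ≤ε ε≤ = begin
    ∣ Fseq x n - Fseq y n ∣
      ≤⟨ ∣p-r∣≤∣p-q∣+∣q-r∣ (Fseq x n) (gx xM) (Fseq y n) ⟩
    ∣ Fseq x n - gx xM ∣ + ∣ gx xM - Fseq y n ∣
      ≤⟨ +-monoʳ-≤ ∣ Fseq x n - gx xM ∣ (∣p-r∣≤∣p-q∣+∣q-r∣ (gx xM) (gx yM) (Fseq y n)) ⟩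
    ∣ Fseq x n - gx xM ∣ + (∣ gx xM - gx yM ∣ + ∣ gx yM - Fseq y n ∣)
      ≡⟨ cong (λ v → ∣ Fseq x n - gx xM ∣ + (∣ gx xM - gx yM ∣ + v))
              (trans (cong (λ v → ∣ v - Fseq y n ∣) agree) (∣p-q∣≡∣q-p∣ (gy yM) (Fseq y n))) ⟩
    ∣ Fseq x n - gx xM ∣ + (∣ gx xM - gx yM ∣ + ∣ Fseq y n - gy yM ∣)
      ≤⟨ +-mono-≤ (Fseq-approx x n (ℕₚ.m⊔n≤o⇒m≤o (index x n) (probe (hitDepth x)) tx))
                  (+-mono-≤ (≤-trans (tentSum-lipschitz (suc (hitDepth x)) [] xM yM)
                                     (*-monoˡ-≤-0≤ (0≤two^ (lipExpOf x)) δ≤ε))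
                            (Fseq-approx y n (ℕₚ.m⊔n≤o⇒m≤o (index y n) (probe (hitDepth y)) ty))) ⟩
    h + (two^ (lipExpOf x) * ε + h)
      ≡⟨ solve 2 (λ h e → h :+ (e :+ h) := (h :+ h) :+ e) refl h (two^ (lipExpOf x) * ε) ⟩
    (h + h) + two^ (lipExpOf x) * ε
      ≡⟨ cong (_+ two^ (lipExpOf x) * ε) (half^-suc+half^-suc (suc n)) ⟩
    half^ (suc n) + two^ (lipExpOf x) * ε ∎
    where
    open ≤-Reasoning
    xM yM h : ℚ
    xM = seq x M
    yM = seq y M
    h  = half^ (2 ℕ.+ n)
    gx gy : ℚ → ℚ
    gx = tentSumOf x
    gy = tentSumOf y
    tx : threshold x n ℕ.≤ M
    tx = ℕₚ.m⊔n≤o⇒m≤o (threshold x n) (threshold y n) late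
    ty : threshold y n ℕ.≤ M
    ty = ℕₚ.m⊔n≤o⇒n≤o (threshold x n) (threshold y n) late
    agree : gx yM ≡ gy yM
    agree = tentSumOf-agree x y (ℕₚ.m⊔n≤o⇒n≤o (index x n) _ tx) (ℕₚ.m⊔n≤o⇒n≤o (index y n) _ ty) (≤-trans δ≤ε ε≤)

  F-respects : ∀ x y → x ≃ y → F x ≃ F y
  F-respects x y x≃y n = ≤-trans
    (Fseq-close x y (suc n) (ℕₚ.≤-trans K≤M′ (ℕₚ.n≤1+n M′)) (x≃y M′) (half^-antimono-≤ probe≤M′))
    (begin
      h + two^ Λ * half^ M′           ≡⟨ cong (h +_) (two^*half^ Λ (2 ℕ.+ n ℕ.+ K)) ⟩
      h + half^ (2 ℕ.+ n ℕ.+ K)        ≤⟨ +-monoʳ-≤ h (half^-antimono-≤ (ℕₚ.m≤m+n (2 ℕ.+ n) K)) ⟩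
      h + h                           ≡⟨ half^-suc+half^-suc (suc n) ⟩
      half^ (suc n)                   ≤⟨ half^-suc≤half^ n ⟩
      half^ n                         ∎)
    where
    open ≤-Reasoning
    h : ℚ
    h = half^ (2 ℕ.+ n)
    Λ K M′ : ℕ
    Λ  = lipExpOf x
    K  = jointThreshold x y (suc n)
    M′ = Λ ℕ.+ (2 ℕ.+ n ℕ.+ K)
    K≤M′ : K ℕ.≤ M′
    K≤M′ = ℕₚ.≤-trans (ℕₚ.m≤n+m K (2 ℕ.+ n)) (ℕₚ.m≤n+m _ Λ)
    probe≤M′ : probe (hitDepth x) ℕ.≤ M′
    probe≤M′ = ℕₚ.≤-trans (ℕₚ.≤-trans (ℕₚ.m≤n⊔m (index x (suc n)) _) (ℕₚ.m≤m⊔n (threshold x (suc n)) (threshold y (suc n)))) K≤M′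

  modulusAt : ℕ → ℕ → ℕ
  modulusAt k d = lipExp 0 (suc d) ℕ.+ (k ℕ.+ suc (probe d))

  modulus : ℕ → ℝ → ℕ
  modulus k x = modulusAt k (hitDepth x)

  F-modulus : ∀ k x y → DistLe x y (modulus k x) → DistLe (F x) (F y) k
  F-modulus k x y x≈y n = ≤-trans
    (p≤q+r⇒p-r≤q (≤-trans (Fseq-close x y (suc n) K≤M δ≤ε ε≤) bound))
    (≤-trans (half^-suc≤half^ n) (p≤two*p (0≤half^ n)))
    where
    h : ℚ
    h = half^ (2 ℕ.+ n)
    Λ c g K Z : ℕ
    Λ = lipExpOf x
    c = probe (hitDepth x)
    g = modulus k x
    K = jointThreshold x y (suc n)
    Z = Λ ℕ.+ (2 ℕ.+ n ℕ.+ K)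
    K<Z : K ℕ.< Z
    K<Z = ℕₚ.<-≤-trans (ℕₚ.m<n+m K {2 ℕ.+ n} (s≤s z≤n)) (ℕₚ.m≤n+m _ Λ)
    K≤M : K ℕ.≤ suc (suc Z)
    K≤M = ℕₚ.≤-trans (ℕₚ.<⇒≤ K<Z) (ℕₚ.≤-trans (ℕₚ.n≤1+n Z) (ℕₚ.n≤1+n (suc Z)))
    c≤K : c ℕ.≤ K
    c≤K = ℕₚ.≤-trans (ℕₚ.m≤n⊔m (index x (suc n)) c) (ℕₚ.m≤m⊔n (threshold x (suc n)) (threshold y (suc n)))
    δ≤ε : ∣ seq x (suc (suc Z)) - seq y (suc (suc Z)) ∣ ≤ half^ Z + half^ g
    δ≤ε = ≤-trans (p-r≤q⇒p≤q+r (x≈y (suc Z))) (≤-reflexive (cong (_+ half^ g) (two*half^-suc Z)))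
    ε≤ : half^ Z + half^ g ≤ half^ c
    ε≤ = ≤-trans
      (+-mono-≤ (half^-antimono-≤ (ℕₚ.<-≤-trans (s≤s c≤K) K<Z))
                (half^-antimono-≤ (ℕₚ.≤-trans (ℕₚ.m≤n+m (suc c) k) (ℕₚ.m≤n+m _ Λ))))
      (≤-reflexive (half^-suc+half^-suc c))
    bound : h + two^ Λ * (half^ Z + half^ g) ≤ half^ (suc n) + half^ k
    bound = begin
      h + two^ Λ * (half^ Z + half^ g)
        ≡⟨ cong (h +_) (trans (*-distribˡ-+ (two^ Λ) (half^ Z) (half^ g))
                              (cong₂ _+_ (two^*half^ Λ (2 ℕ.+ n ℕ.+ K)) (two^*half^ Λ (k ℕ.+ suc c)))) ⟩
      h + (half^ (2 ℕ.+ n ℕ.+ K) + half^ (k ℕ.+ suc c))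
        ≤⟨ +-monoʳ-≤ h (+-mono-≤ (half^-antimono-≤ (ℕₚ.m≤m+n (2 ℕ.+ n) K)) (half^-antimono-≤ (ℕₚ.m≤m+n k (suc c)))) ⟩
      h + (h + half^ k)
        ≡⟨ solve 2 (λ h e → h :+ (h :+ e) := (h :+ h) :+ e) refl h (half^ k) ⟩
      (h + h) + half^ k
        ≡⟨ cong (_+ half^ k) (half^-suc+half^-suc (suc n)) ⟩
      half^ (suc n) + half^ k ∎
      where open ≤-Reasoning

  modulus-continuous : ∀ k → IsPointwiseContinuous (λ α → modulus k (val (Φ α)))
  modulus-continuous k α = probe (hitDepth φ) , λ β e →
    cong (modulusAt k) (sym (hitDepth-local φ (val (Φ β)) (λ {j} j<L →
      Φseq-local α β (probe j) (initSeg-prefix α β (probe-mono-≤ (ℕₚ.<⇒≤ j<L)) e))))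
    where
    φ : ℝ
    φ = val (Φ α)

  F-const : ∀ a r → Inside (initSeg a (firstHit a)) r → ∀ n → Fseq (constℝ r) n ≡ tent (initSeg a (firstHit a)) r
  F-const a r inside n = begin
    tentSum (suc (hitDepth (constℝ r))) [] r  ≡⟨ tentSum-settled₂ settled-own (settled-above L (ℕₚ.+-identityʳ L)) ⟩
    tentSum (suc L) [] r                     ≡⟨ tentSum-above L (ℕₚ.+-identityʳ L) ⟩
    tent (initSeg a L) r                     ∎
    where
    open ≡-Reasoning
    open FirstPrefix a (firstHit-holds a) (firstHit-minimal a) r inside
    L : ℕ
    L = firstHit a
    settled-own : Settled (suc (hitDepth (constℝ r))) [] r
    settled-own = settled-near (constℝ r) r (hitDepth-holds (constℝ r)) ℕₚ.≤-refl
      (≤-trans (≤-reflexive (cong ∣_∣ (+-inverseʳ r))) (0≤half^ (probe (hitDepth (constℝ r)))))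

  -- ≤ᵇ evaluates to false on these closed rationals.
  1-¼≰½ : ¬ (∣ 1ℚ - 0ℚ ∣ - half^ 2 ≤ two * half^ 2)
  1-¼≰½ = ≤⇒≤ᵇ

  F-continuousTernaryModulus : IsContinuousTernaryModulus (F ∘ val) (λ k α → modulus k (val (Φ α)))
  F-continuousTernaryModulus = (λ k α x → F-modulus k (val (Φ α)) (val x)) , modulus-continuous

  firstHit-bounded : (uc : IsUniformlyContinuous (F ∘ val)) → ∀ a → firstHit a ℕ.≤ proj₁ uc 2
  firstHit-bounded (ω , ω-uc) a = ℕₚ.≮⇒≥ deep
    where
    open FirstPrefix a (firstHit-holds a) (firstHit-minimal a) using (inside-above)
    L : ℕ
    L = firstHit a
    s : List Bool
    s = initSeg a L
    p q : ℚ
    p = centre s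
    q = p + radius (depth s)
    ∣q-p∣ : ∣ q - p ∣ ≡ radius (depth s)
    ∣q-p∣ = trans (cong ∣_∣ (solve 2 (λ p r → (p :+ r) :- p := r) refl p (radius (depth s))))
                  (0≤p⇒∣p∣≡p (0≤half^ (radiusExp (depth s))))
    inside-p : Inside s p
    inside-p = ≤-trans (≤-reflexive (cong ∣_∣ (+-inverseʳ p))) (0≤half^ (radiusExp (depth s)))
    inside-q : Inside s q
    inside-q = ≤-reflexive ∣q-p∣
    P Q : I
    P = inside-root⇒I p (inside-above p inside-p L (ℕₚ.+-identityʳ L))
    Q = inside-root⇒I q (inside-above q inside-q L (ℕₚ.+-identityʳ L))
    close : ω 2 ℕ.< L → DistLe (val P) (val Q) (ω 2)
    close N<L m = ≤-trans (p≤q+r⇒p-r≤q (≤-trans ∣p-q∣≤ (≤-reflexive (sym (+-identityˡ (half^ (ω 2)))))))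
                          (*-nonNeg 0≤two (0≤half^ m))
      where
      ∣p-q∣≤ : ∣ p - q ∣ ≤ half^ (ω 2)
      ∣p-q∣≤ = ≤-trans (≤-reflexive (trans (∣p-q∣≡∣q-p∣ p q) ∣q-p∣))
        (half^-antimono-≤ (subst (λ d → ω 2 ℕ.≤ radiusExp d) (sym (depth-initSeg a L))
                                 (ℕₚ.≤-trans (ℕₚ.<⇒≤ N<L) (n≤radiusExp L))))
    deep : ¬ (ω 2 ℕ.< L)
    deep N<L = 1-¼≰½ (subst₂ (λ u v → ∣ u - v ∣ - half^ 2 ≤ two * half^ 2)
      (trans (F-const a p inside-p 3) (tent-centre s))
      (trans (F-const a q inside-q 3) (tent-vanishes s {q} (≤-reflexive (sym ∣q-p∣))))
      (ω-uc 2 P Q (close N<L) 2))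

proposition5p17 : UCTc' → DFT
proposition5p17 uct B B? bar = proj₁ uc 2 , λ a → firstHit a , firstHit-bounded uc a , firstHit-holds a
  where
  open BarFunction B? bar
  uc : IsUniformlyContinuous (F ∘ val)
  uc = uct (F ∘ val) (λ x y → F-respects (val x) (val y)) (_ , F-continuousTernaryModulus)
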